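{- Let $\mathcal{A}$ be a union-closed family with universe $[n]=\{1,\dots,n\}$ and length $\ell$. Then for every nonnegative integer $p$, \[|\mathcal{A}| \le \frac{\ell^{p}-1}{\ell-1} + 2^n\left(1-2^{ -\ell}\right)^{p},\] where $\frac{\ell^{p}-1}{\ell-1}$ is understood as $\sum_{j=0}^{p-1}\ell^j$ (with $0^0=1$; so it equals $p$ when $\ell=1$).
   Context: A family $\mathcal{A}$ is a finite family of distinct finite sets, at least one of which is nonempty. Its universe is $U(\mathcal{A})=\bigcup_{A\in\mathcal{A}}A$. $\mathcal{A}$ is union-closed if $X_1,X_2\in\mathcal{A}$ implies $X_1\cup X_2\in\mathcal{A}$. A chain in $\mathcal{A}$ is a subfamily any two of whose members are comparable under inclusion; the length $\ell(\mathcal{A})$ is one less than the maximum size of a chain in $\mathcal{A}$. -}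

module Defs where

open import Data.Nat using (ℕ; zero; suc; _+_; _*_; _^_; _≤_)
open import Data.Fin.Subset using (Subset; _⊆_; _∪_; ⋃; ⊤; Nonempty)
open import Data.List using (List; length)
open import Data.List.Membership.Propositional using (_∈_)
open import Data.List.Relation.Unary.Unique.Propositional using (Unique)
open import Data.List.Relation.Unary.All using (All)
open import Data.List.Relation.Unary.Any using (Any)
open import Data.Product using (Σ; _×_)
open import Data.Sum using (_⊎_)
open import Relation.Binary.PropositionalEquality using (_≡_)
import Data.Rational as ℚ
open import Data.Integer using (+_)

record Family (n : ℕ) : Set where
  field
    sets     : List (Subset n)
    distinct : Unique sets
    someNonempty : Any Nonempty sets
open Family public

∣_∣F : ∀ {n} → Family n → ℕ
∣ F ∣F = length (sets F)

Universe : ∀ {n} → Family n → Subset n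
Universe F = ⋃ (sets F)

UnionClosed : ∀ {n} → Family n → Set
UnionClosed F = ∀ {X Y} → X ∈ sets F → Y ∈ sets F → (X ∪ Y) ∈ sets F

IsChain : ∀ {n} → Family n → List (Subset n) → Set
IsChain F C = Unique C × All (_∈ sets F) C
            × (∀ {X Y} → X ∈ C → Y ∈ C → X ⊆ Y ⊎ Y ⊆ X)

-- ℓ(F) = ℓ : the maximum size of a chain in F equals ℓ + 1
HasLength : ∀ {n} → Family n → ℕ → Set
HasLength F ℓ = Σ (List _) (λ C → IsChain F C × length C ≡ suc ℓ)
              × (∀ C → IsChain F C → length C ≤ suc ℓ)

geomSum : ℕ → ℕ → ℕ
geomSum ℓ zero    = 0
geomSum ℓ (suc p) = geomSum ℓ p + ℓ ^ p

ℕtoℚ : ℕ → ℚ.ℚ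
ℕtoℚ k = (+ k) ℚ./ 1

powℚ : ℚ.ℚ → ℕ → ℚ.ℚ
powℚ q zero    = ℚ.1ℚ
powℚ q (suc p) = q ℚ.* powℚ q p

bound2 : ℕ → ℕ → ℕ → ℚ.ℚ
bound2 n ℓ p = ℕtoℚ (2 ^ n) ℚ.* powℚ (ℚ.1ℚ ℚ.- powℚ ℚ.½ ℓ) p

-- View the family inside a subcube of {0,1}ⁿ of dimension d, and put g_p = Σ_{j<p} ℓʲ and
-- x_p = (1 − 2^{−ℓ})^p.  By induction on p, every union-closed family L in a d-dimensional subcube
-- whose chains have at most ℓ + 1 members satisfies |L| ≤ g_p + 2^d x_p; for p = 0 this is |L| ≤ 2^d.
-- For the step, let T = ⋃ L, which lies in L, and pick a coordinate i on which T differs from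
-- another member (so i ∈ T and i is free in the subcube).  Slicing L along i gives two union-closed
-- families in subcubes of dimension d − 1: the slice containing i is bounded by the hypothesis for p,
-- while every chain of the slice avoiding i extends by T, so that slice has shorter chains.
-- Induction on k ≤ ℓ then gives |L| ≤ 1 + k g_p + 2^d x_p (1 − 2^{−k}) when chains have at most
-- k + 1 members, and k = ℓ is the bound for p + 1.
module Submission where

open import Defs
open import Data.Nat using (ℕ)
open import Data.Fin.Subset using (⊤)
open import Relation.Binary.PropositionalEquality using (_≡_)
import Data.Rational as ℚ

open import Data.Bool using (Bool; true; false; _∨_) renaming (_≟_ to _≟ᴮ_)
open import Data.Bool.Properties using (∨-idem)
open import Data.Maybe using (Maybe; just; nothing)
open import Data.Fin using (Fin; zero; suc) renaming (_≟_ to _≟ᶠ_)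
open import Data.Fin.Subset using (Subset; _⊆_; _∪_; ⋃; inside; outside)
open import Data.Fin.Subset.Properties using (p⊆p∪q; q⊆p∪q; ∪-identityʳ; drop-∷-⊆)
open import Data.Vec as Vec using (Vec; []; _∷_; lookup; replicate; _[_]≔_)
open import Data.Vec.Properties
  using (lookup∘update; lookup∘update′; lookup-replicate; lookup-zipWith; ≡-dec)
open import Data.List using (List; []; _∷_; length; filter)
open import Data.List.Membership.Propositional using (_∈_)
open import Data.List.Membership.Propositional.Properties using (∈-filter⁺; ∈-filter⁻)
open import Data.List.Relation.Unary.All as All using (All; []; _∷_)
open import Data.List.Relation.Unary.Any using (here; there)
open import Data.List.Relation.Unary.AllPairs as AllPairs using ([]; _∷_)
open import Data.List.Relation.Unary.Unique.Propositional using (Unique)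
import Data.List.Relation.Unary.Unique.Propositional.Properties as Unique
open import Data.Product using (∃-syntax; _×_; _,_; proj₁; proj₂)
open import Data.Sum using (_⊎_; inj₁; inj₂)
open import Data.Unit using (tt) renaming (⊤ to Unit)
open import Function using (_∘_; id)
open import Relation.Nullary using (yes; no; contradiction)
open import Relation.Binary.Definitions using (DecidableEquality)
open import Relation.Binary.PropositionalEquality
  using (_≢_; refl; sym; trans; cong; cong₂; subst; subst₂; module ≡-Reasoning)

module _ where
  open import Data.Nat using (zero; suc; _+_; _^_; _≤_; z≤n; s≤s; s≤s⁻¹)
  open import Data.Nat.Properties
    using (+-suc; +-identityʳ; +-mono-≤; suc-injective; module ≤-Reasoning)

  length≤1 : ∀ {A : Set} {xs : List A} →
             Unique xs → (∀ {x y} → x ∈ xs → y ∈ xs → x ≡ y) → length xs ≤ 1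
  length≤1 {xs = []}        _               _    = z≤n
  length≤1 {xs = _ ∷ []}    _               _    = s≤s z≤n
  length≤1 {xs = _ ∷ _ ∷ _} ((x≢y ∷ _) ∷ _) same =
    contradiction (same (here refl) (there (here refl))) x≢y

  member-≢ : ∀ {A : Set} → DecidableEquality A → ∀ {L : List A} {X Y} T →
             X ∈ L → Y ∈ L → X ≢ Y → ∃[ a ] a ∈ L × a ≢ T
  member-≢ _≟_ {X = X} T X∈L Y∈L X≢Y with X ≟ T
  ... | yes refl = _ , Y∈L , X≢Y ∘ sym
  ... | no X≢T   = _ , X∈L , X≢T

  ⊆∧≢⇒separated : ∀ {n} {p q : Subset n} → p ⊆ q → p ≢ q →
                  ∃[ i ] lookup p i ≡ outside × lookup q i ≡ inside
  ⊆∧≢⇒separated {p = []}          {[]}          _   p≢q = contradiction refl p≢q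
  ⊆∧≢⇒separated {p = outside ∷ _} {inside ∷ _}  _   _   = zero , refl , refl
  ⊆∧≢⇒separated {p = inside ∷ _}  {outside ∷ _} p⊆q _   with p⊆q Vec.here
  ... | ()
  ⊆∧≢⇒separated {p = inside ∷ _}  {inside ∷ _}  p⊆q p≢q
    with ⊆∧≢⇒separated (drop-∷-⊆ p⊆q) (p≢q ∘ cong (inside ∷_))
  ... | i , pᵢ , qᵢ = suc i , pᵢ , qᵢ
  ⊆∧≢⇒separated {p = outside ∷ _} {outside ∷ _} p⊆q p≢q
    with ⊆∧≢⇒separated (drop-∷-⊆ p⊆q) (p≢q ∘ cong (outside ∷_))
  ... | i , pᵢ , qᵢ = suc i , pᵢ , qᵢ

  -- A subcube of {0,1}ⁿ fixes some coordinates (just s) and leaves the others free (nothing).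
  Cube : ℕ → Set
  Cube = Vec (Maybe Bool)

  Fits : Maybe Bool → Bool → Set
  Fits nothing  _ = Unit
  Fits (just s) x = x ≡ s

  record _∈ᶜ_ {n} (X : Subset n) (c : Cube n) : Set where
    constructor fits
    field at : ∀ i → Fits (lookup c i) (lookup X i)
  open _∈ᶜ_

  dim : ∀ {n} → Cube n → ℕ
  dim []            = 0
  dim (nothing ∷ c) = suc (dim c)
  dim (just _ ∷ c)  = dim c

  full : ∀ n → Cube n
  full n = replicate n nothing

  fix : ∀ {n} → Cube n → Fin n → Bool → Cube n
  fix c i s = c [ i ]≔ just s

  dim-full : ∀ n → dim (full n) ≡ n
  dim-full zero    = refl
  dim-full (suc n) = cong suc (dim-full n)

  ∈ᶜ-full : ∀ {n} (X : Subset n) → X ∈ᶜ full n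
  ∈ᶜ-full X = fits λ i → subst (λ m → Fits m (lookup X i)) (sym (lookup-replicate i nothing)) tt

  dim-fix : ∀ {n} (c : Cube n) {i} s → lookup c i ≡ nothing → dim c ≡ suc (dim (fix c i s))
  dim-fix (nothing ∷ c) {zero}  s _    = refl
  dim-fix (nothing ∷ c) {suc i} s free = cong suc (dim-fix c s free)
  dim-fix (just _ ∷ c)  {suc i} s free = dim-fix c s free

  free-coordinate : ∀ {n d} (c : Cube n) → dim c ≡ suc d → ∃[ i ] lookup c i ≡ nothing
  free-coordinate (nothing ∷ c) _ = zero , refl
  free-coordinate (just _ ∷ c)  dc with free-coordinate c dc
  ... | i , free = suc i , free

  ∈ᶜ-fix : ∀ {n} {c : Cube n} {X i s} → X ∈ᶜ c → lookup X i ≡ s → X ∈ᶜ fix c i s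
  ∈ᶜ-fix {c = c} {X} {i} {s} X∈c Xᵢ = fits fixed
    where
    fixed : ∀ j → Fits (lookup (fix c i s) j) (lookup X j)
    fixed j with i ≟ᶠ j
    ... | yes refl rewrite lookup∘update i c (just s) = Xᵢ
    ... | no i≢j   =
      subst (λ m → Fits m (lookup X j)) (sym (lookup∘update′ (i≢j ∘ sym) c (just s))) (at X∈c j)

  separated⇒free : ∀ {n} {c : Cube n} {X Y i} →
                   X ∈ᶜ c → Y ∈ᶜ c → lookup X i ≢ lookup Y i → lookup c i ≡ nothing
  separated⇒free {c = c} {i = i} X∈c Y∈c Xᵢ≢Yᵢ with lookup c i | at X∈c i | at Y∈c i
  ... | nothing | _  | _  = refl
  ... | just _  | Xᵢ | Yᵢ = contradiction (trans Xᵢ (sym Yᵢ)) Xᵢ≢Yᵢ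

  dim0⇒point : ∀ {n} {c : Cube n} {X Y} → dim c ≡ 0 → X ∈ᶜ c → Y ∈ᶜ c → X ≡ Y
  dim0⇒point {c = []}         {[]}    {[]}    _  _   _   = refl
  dim0⇒point {c = just _ ∷ c} {_ ∷ _} {_ ∷ _} d0 X∈c Y∈c =
    cong₂ _∷_ (trans (at X∈c zero) (sym (at Y∈c zero)))
              (dim0⇒point {c = c} d0 (fits (at X∈c ∘ suc)) (fits (at Y∈c ∘ suc)))

  module _ {n : ℕ} where

    record FamilyIn (c : Cube n) (L : List (Subset n)) : Set where
      field
        unique  : Unique L
        members : All (_∈ᶜ c) L
    open FamilyIn public

    ∪-Closed : List (Subset n) → Set
    ∪-Closed L = ∀ {X Y} → X ∈ L → Y ∈ L → (X ∪ Y) ∈ L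

    IsChainIn : List (Subset n) → List (Subset n) → Set
    IsChainIn L C = Unique C × All (_∈ L) C × (∀ {X Y} → X ∈ C → Y ∈ C → X ⊆ Y ⊎ Y ⊆ X)

    ChainsBounded : List (Subset n) → ℕ → Set
    ChainsBounded L m = ∀ C → IsChainIn L C → length C ≤ m

    slice : Fin n → Bool → List (Subset n) → List (Subset n)
    slice i s = filter (λ X → lookup X i ≟ᴮ s)

    length-slices : ∀ i L → length L ≡ length (slice i true L) + length (slice i false L)
    length-slices i []      = refl
    length-slices i (X ∷ L) with lookup X i
    ... | true  = cong suc (length-slices i L)
    ... | false = trans (cong suc (length-slices i L)) (sym (+-suc _ _))

    ∈-slice⁻ : ∀ {i s L X} → X ∈ slice i s L → X ∈ L × lookup X i ≡ s
    ∈-slice⁻ {i} {s} = ∈-filter⁻ (λ X → lookup X i ≟ᴮ s)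

    ∈-slice⁺ : ∀ {i s L X} → X ∈ L → lookup X i ≡ s → X ∈ slice i s L
    ∈-slice⁺ {i} {s} = ∈-filter⁺ (λ X → lookup X i ≟ᴮ s)

    slice-familyIn : ∀ {c L} i s → FamilyIn c L → FamilyIn (fix c i s) (slice i s L)
    slice-familyIn i s fam = record
      { unique  = Unique.filter⁺ (λ X → lookup X i ≟ᴮ s) (unique fam)
      ; members = All.tabulate λ {X} X∈ →
          let X∈L , Xᵢ = ∈-slice⁻ X∈ in ∈ᶜ-fix (All.lookup (members fam) X∈L) Xᵢ
      }

    slice-∪-closed : ∀ {L} i s → ∪-Closed L → ∪-Closed (slice i s L)
    slice-∪-closed {L} i s closed {X} {Y} X∈ Y∈
      with ∈-slice⁻ {i} {s} {L} X∈ | ∈-slice⁻ {i} {s} {L} Y∈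
    ... | X∈L , refl | Y∈L , Yᵢ = ∈-slice⁺ (closed X∈L Y∈L)
      (trans (lookup-zipWith _∨_ i X Y) (trans (cong (lookup X i ∨_) Yᵢ) (∨-idem _)))

    slice-chain : ∀ {L C i s} → IsChainIn (slice i s L) C → IsChainIn L C
    slice-chain (unique , C⊆ , comparable) = unique , All.map (proj₁ ∘ ∈-slice⁻) C⊆ , comparable

    slice-chainsBounded : ∀ {L m} i s → ChainsBounded L m → ChainsBounded (slice i s L) m
    slice-chainsBounded i s bounded C = bounded C ∘ slice-chain

    length≤2^dim : ∀ d {c : Cube n} {L} → dim c ≡ d → FamilyIn c L → length L ≤ 2 ^ d
    length≤2^dim zero {c} d0 fam = length≤1 (unique fam) λ X∈ Y∈ →
      dim0⇒point {c = c} d0 (All.lookup (members fam) X∈) (All.lookup (members fam) Y∈)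
    length≤2^dim (suc d) {c} {L} dc fam with free-coordinate c dc
    ... | i , free = begin
      length L                                           ≡⟨ length-slices i L ⟩
      length (slice i true L) + length (slice i false L) ≤⟨ +-mono-≤ (half true) (half false) ⟩
      2 ^ d + 2 ^ d                                      ≡⟨ cong (2 ^ d +_) (sym (+-identityʳ _)) ⟩
      2 ^ suc d                                          ∎
      where
      open ≤-Reasoning
      half : ∀ s → length (slice i s L) ≤ 2 ^ d
      half s = length≤2^dim d (suc-injective (trans (sym (dim-fix c s free)) dc))
                              (slice-familyIn i s fam)

    ⊆⋃ : ∀ {L : List (Subset n)} {Y} → Y ∈ L → Y ⊆ ⋃ L
    ⊆⋃ {X ∷ L} (here refl) = p⊆p∪q (⋃ L)
    ⊆⋃ {X ∷ L} (there Y∈L) x∈Y = q⊆p∪q X (⋃ L) (⊆⋃ Y∈L x∈Y)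

    ⋃-∈ : ∀ {L X Xs} → ∪-Closed L → All (_∈ L) (X ∷ Xs) → ⋃ (X ∷ Xs) ∈ L
    ⋃-∈ {L} {X} {[]}    _      (X∈L ∷ [])   = subst (_∈ L) (sym (∪-identityʳ X)) X∈L
    ⋃-∈ {L} {X} {_ ∷ _} closed (X∈L ∷ Xs⊆L) = closed X∈L (⋃-∈ closed Xs⊆L)

    singleton-chain : ∀ {L X} → X ∈ L → IsChainIn L (X ∷ [])
    singleton-chain X∈L = ([] ∷ []) , (X∈L ∷ []) , λ { (here refl) (here refl) → inj₁ id }

    ∷-chain : ∀ {L C T} → T ∈ L → All (λ Y → Y ⊆ T × Y ≢ T) C →
              IsChainIn L C → IsChainIn L (T ∷ C)
    ∷-chain {C = C} {T} T∈L C⊂T (unique , C⊆L , comparable) =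
      (All.map (λ Y⊂T T≡Y → proj₂ Y⊂T (sym T≡Y)) C⊂T ∷ unique) , (T∈L ∷ C⊆L) , comparable′
      where
      comparable′ : ∀ {X Y} → X ∈ T ∷ C → Y ∈ T ∷ C → X ⊆ Y ⊎ Y ⊆ X
      comparable′ (here refl) (here refl) = inj₁ id
      comparable′ (here refl) (there Y∈) = inj₂ (proj₁ (All.lookup C⊂T Y∈))
      comparable′ (there X∈)  (here refl) = inj₁ (proj₁ (All.lookup C⊂T X∈))
      comparable′ (there X∈)  (there Y∈) = comparable X∈ Y∈

    slice-outside-chainsBounded : ∀ {L T i k} → T ∈ L → (∀ {Y} → Y ∈ L → Y ⊆ T) →
      lookup T i ≡ inside → ChainsBounded L (suc k) → ChainsBounded (slice i outside L) k
    slice-outside-chainsBounded {L} {T} {i} T∈L ⊆T Tᵢ bounded C chain@(_ , C⊆ , _) =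
      s≤s⁻¹ (bounded (T ∷ C) (∷-chain T∈L (All.map below-T C⊆) (slice-chain {L} {C} {i} chain)))
      where
      below-T : ∀ {Y} → Y ∈ slice i outside L → Y ⊆ T × Y ≢ T
      below-T Y∈ with ∈-slice⁻ {i} {outside} {L} Y∈
      ... | Y∈L , Yᵢ = ⊆T Y∈L , λ { refl → contradiction (trans (sym Yᵢ) Tᵢ) λ () }

    free-separation : ∀ {c : Cube n} {L T a} →
      All (_∈ᶜ c) L → T ∈ L → a ∈ L → a ⊆ T → a ≢ T →
      ∃[ i ] lookup c i ≡ nothing × lookup T i ≡ inside × lookup a i ≡ outside
    free-separation {T = T} {a} L⊆c T∈L a∈L a⊆T a≢T with ⊆∧≢⇒separated a⊆T a≢T
    ... | i , aᵢ , Tᵢ =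
      i , separated⇒free (All.lookup L⊆c a∈L) (All.lookup L⊆c T∈L) aᵢ≢Tᵢ , Tᵢ , aᵢ
      where
      aᵢ≢Tᵢ : lookup a i ≢ lookup T i
      aᵢ≢Tᵢ aᵢ≡Tᵢ = contradiction (trans (sym aᵢ) (trans aᵢ≡Tᵢ Tᵢ)) λ ()

    separating-coordinate : ∀ {c : Cube n} {L T X Y} →
      All (_∈ᶜ c) L → T ∈ L → (∀ {Z} → Z ∈ L → Z ⊆ T) → X ∈ L → Y ∈ L → X ≢ Y →
      ∃[ i ] lookup c i ≡ nothing × lookup T i ≡ inside × ∃[ a ] a ∈ L × lookup a i ≡ outside
    separating-coordinate {T = T} L⊆c T∈L ⊆T X∈L Y∈L X≢Y
      with member-≢ (≡-dec _≟ᴮ_) T X∈L Y∈L X≢Y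
    ... | a , a∈L , a≢T with free-separation L⊆c T∈L a∈L (⊆T a∈L) a≢T
    ... | i , free , Tᵢ , aᵢ = i , free , Tᵢ , a , a∈L , aᵢ

module _ where
  open import Data.Nat as ℕ using (zero; suc)
  import Data.Nat.Properties as ℕₚ
  open import Data.Nat.Tactic.RingSolver using (solve-∀)
  open import Data.Integer as ℤ using (+_)
  import Data.Integer.Properties as ℤ
  import Data.Nat.Coprimality as Coprimality
  open import Data.Rational
    using (ℚ; mkℚ; _/_; 0ℚ; 1ℚ; ½; _+_; _*_; _-_; _≤_; *≤*; NonNegative)
  open import Data.Rational.Properties
  open import Data.Rational.Solver using (module +-*-Solver)
  open +-*-Solver using (solve; _:+_; _:*_; _:-_; _:=_; con)

  ℕtoℚ≡mkℚ : ∀ m → ℕtoℚ m ≡ mkℚ (+ m) 0 (Coprimality.sym (Coprimality.1-coprimeTo m))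
  ℕtoℚ≡mkℚ m = normalize-coprime (Coprimality.sym (Coprimality.1-coprimeTo m))

  ℕtoℚ-+ : ∀ m n → ℕtoℚ (m ℕ.+ n) ≡ ℕtoℚ m + ℕtoℚ n
  ℕtoℚ-+ m n =
    trans (cong (_/ 1) (sym numerators)) (sym (cong₂ _+_ (ℕtoℚ≡mkℚ m) (ℕtoℚ≡mkℚ n)))
    where
    numerators : + m ℤ.* + 1 ℤ.+ + n ℤ.* + 1 ≡ + (m ℕ.+ n)
    numerators =
      trans (cong₂ ℤ._+_ (ℤ.*-identityʳ (+ m)) (ℤ.*-identityʳ (+ n))) (sym (ℤ.pos-+ m n))

  ℕtoℚ-* : ∀ m n → ℕtoℚ (m ℕ.* n) ≡ ℕtoℚ m * ℕtoℚ n
  ℕtoℚ-* m n = trans (cong (_/ 1) (ℤ.pos-* m n)) (sym (cong₂ _*_ (ℕtoℚ≡mkℚ m) (ℕtoℚ≡mkℚ n)))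

  ℕtoℚ-mono-≤ : ∀ {m n} → m ℕ.≤ n → ℕtoℚ m ≤ ℕtoℚ n
  ℕtoℚ-mono-≤ {m} {n} m≤n = subst₂ _≤_ (sym (ℕtoℚ≡mkℚ m)) (sym (ℕtoℚ≡mkℚ n))
    (*≤* (subst₂ ℤ._≤_ (sym (ℤ.*-identityʳ (+ m))) (sym (ℤ.*-identityʳ (+ n))) (ℤ.+≤+ m≤n)))

  ℕtoℚ-nonNeg : ∀ m → NonNegative (ℕtoℚ m)
  ℕtoℚ-nonNeg m = normalize-nonNeg m 1

  powℚ-nonNeg : ∀ q .{{_ : NonNegative q}} p → NonNegative (powℚ q p)
  powℚ-nonNeg q zero    = _
  powℚ-nonNeg q (suc p) = nonNeg*nonNeg⇒nonNeg q (powℚ q p) {{powℚ-nonNeg q p}}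

  1-½^-nonNeg : ∀ k → NonNegative (1ℚ - powℚ ½ k)
  1-½^-nonNeg zero    = _
  1-½^-nonNeg (suc k) = subst NonNegative (sym (halving (powℚ ½ k)))
    (nonNeg+nonNeg⇒nonNeg ½ (½ * (1ℚ - powℚ ½ k))
      {{nonNeg*nonNeg⇒nonNeg ½ (1ℚ - powℚ ½ k) {{1-½^-nonNeg k}}}})
    where
    halving : ∀ h → 1ℚ - ½ * h ≡ ½ + ½ * (1ℚ - h)
    halving = solve 1 (λ h → con 1ℚ :- con ½ :* h := con ½ :+ con ½ :* (con 1ℚ :- h)) refl

  geomSum-suc : ∀ ℓ p → geomSum ℓ (suc p) ≡ 1 ℕ.+ ℓ ℕ.* geomSum ℓ p
  geomSum-suc ℓ zero    = cong suc (sym (ℕₚ.*-zeroʳ ℓ))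
  geomSum-suc ℓ (suc p) =
    trans (cong (ℕ._+ ℓ ℕ.^ suc p) (geomSum-suc ℓ p)) (distrib (geomSum ℓ p) (ℓ ℕ.^ p) ℓ)
    where
    distrib : ∀ g x ℓ → 1 ℕ.+ ℓ ℕ.* g ℕ.+ ℓ ℕ.* x ≡ 1 ℕ.+ ℓ ℕ.* (g ℕ.+ x)
    distrib = solve-∀

  ℕtoℚ-geomSum-suc : ∀ ℓ p → ℕtoℚ (geomSum ℓ (suc p)) ≡ 1ℚ + ℕtoℚ ℓ * ℕtoℚ (geomSum ℓ p)
  ℕtoℚ-geomSum-suc ℓ p = begin
    ℕtoℚ (geomSum ℓ (suc p))          ≡⟨ cong ℕtoℚ (geomSum-suc ℓ p) ⟩
    ℕtoℚ (1 ℕ.+ ℓ ℕ.* geomSum ℓ p)    ≡⟨ ℕtoℚ-+ 1 (ℓ ℕ.* geomSum ℓ p) ⟩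
    1ℚ + ℕtoℚ (ℓ ℕ.* geomSum ℓ p)     ≡⟨ cong (λ r → 1ℚ + r) (ℕtoℚ-* ℓ (geomSum ℓ p)) ⟩
    1ℚ + ℕtoℚ ℓ * ℕtoℚ (geomSum ℓ p)  ∎
    where open ≡-Reasoning

  bound2-nonNeg : ∀ d ℓ p → NonNegative (bound2 d ℓ p)
  bound2-nonNeg d ℓ p = nonNeg*nonNeg⇒nonNeg (ℕtoℚ (2 ℕ.^ d)) {{ℕtoℚ-nonNeg (2 ℕ.^ d)}}
    (powℚ (1ℚ - powℚ ½ ℓ) p) {{powℚ-nonNeg _ {{1-½^-nonNeg ℓ}} p}}

  bound2-suc-dim : ∀ d ℓ p → bound2 (suc d) ℓ p ≡ ℕtoℚ 2 * bound2 d ℓ p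
  bound2-suc-dim d ℓ p = trans (cong (_* powℚ (1ℚ - powℚ ½ ℓ) p) (ℕtoℚ-* 2 (2 ℕ.^ d)))
                               (*-assoc (ℕtoℚ 2) (ℕtoℚ (2 ℕ.^ d)) _)

  bound2-suc-exp : ∀ d ℓ p → bound2 d ℓ (suc p) ≡ bound2 d ℓ p * (1ℚ - powℚ ½ ℓ)
  bound2-suc-exp d ℓ p = swap (ℕtoℚ (2 ℕ.^ d)) (1ℚ - powℚ ½ ℓ) (powℚ (1ℚ - powℚ ½ ℓ) p)
    where
    swap : ∀ e q x → e * (q * x) ≡ e * x * q
    swap = solve 3 (λ e q x → e :* (q :* x) := e :* x :* q) refl

  interpolation-step : ∀ S B k h →
    (S + B) + (1ℚ + (k * S + B * (1ℚ - h))) ≡ 1ℚ + ((1ℚ + k) * S + (ℕtoℚ 2 * B) * (1ℚ - ½ * h))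
  interpolation-step = solve 4 (λ S B k h →
    (S :+ B) :+ (con 1ℚ :+ (k :* S :+ B :* (con 1ℚ :- h)))
      := con 1ℚ :+ ((con 1ℚ :+ k) :* S :+ (con (ℕtoℚ 2) :* B) :* (con 1ℚ :- con ½ :* h))) refl

  ≤1⇒≤1+ : ∀ {m} r → .{{NonNegative r}} → m ℕ.≤ 1 → ℕtoℚ m ≤ 1ℚ + r
  ≤1⇒≤1+ {m} r m≤1 = begin
    ℕtoℚ m   ≤⟨ ℕtoℚ-mono-≤ m≤1 ⟩
    1ℚ       ≡⟨ sym (+-identityʳ 1ℚ) ⟩
    1ℚ + 0ℚ  ≤⟨ +-monoʳ-≤ 1ℚ (nonNegative⁻¹ r) ⟩
    1ℚ + r   ∎
    where open ≤-Reasoning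

  interpolant : ℕ → ℕ → ℕ → ℕ → ℚ
  interpolant ℓ p k d = 1ℚ + (ℕtoℚ k * ℕtoℚ (geomSum ℓ p) + bound2 d ℓ p * (1ℚ - powℚ ½ k))

  ≤1⇒≤interpolant : ∀ ℓ p k d {m} → m ℕ.≤ 1 → ℕtoℚ m ≤ interpolant ℓ p k d
  ≤1⇒≤interpolant ℓ p k d = ≤1⇒≤1+ (kg + Bh) {{nonNeg+nonNeg⇒nonNeg kg {{kg≥0}} Bh {{Bh≥0}}}}
    where
    kg = ℕtoℚ k * ℕtoℚ (geomSum ℓ p)
    Bh = bound2 d ℓ p * (1ℚ - powℚ ½ k)
    kg≥0 = nonNeg*nonNeg⇒nonNeg (ℕtoℚ k) {{ℕtoℚ-nonNeg k}}
                                (ℕtoℚ (geomSum ℓ p)) {{ℕtoℚ-nonNeg (geomSum ℓ p)}}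
    Bh≥0 = nonNeg*nonNeg⇒nonNeg (bound2 d ℓ p) {{bound2-nonNeg d ℓ p}}
                                (1ℚ - powℚ ½ k) {{1-½^-nonNeg k}}

  GeometricBound : ℕ → ℕ → Set
  GeometricBound ℓ p = ∀ {n} {c : Cube n} {L} →
    FamilyIn c L → ∪-Closed L → ChainsBounded L (suc ℓ) →
    ℕtoℚ (length L) ≤ ℕtoℚ (geomSum ℓ p) + bound2 (dim c) ℓ p

  geometricBound-zero : ∀ {ℓ} → GeometricBound ℓ 0
  geometricBound-zero {ℓ} {c = c} {L} fam _ _ = begin
    ℕtoℚ (length L)          ≤⟨ ℕtoℚ-mono-≤ (length≤2^dim (dim c) refl fam) ⟩
    ℕtoℚ (2 ℕ.^ dim c)       ≡⟨ sym (*-identityʳ _) ⟩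
    bound2 (dim c) ℓ 0       ≡⟨ sym (+-identityˡ _) ⟩
    0ℚ + bound2 (dim c) ℓ 0  ∎
    where open ≤-Reasoning

  module _ {ℓ p : ℕ} (bound-p : GeometricBound ℓ p) where

    interpolated-bound : ∀ k → k ℕ.≤ ℓ → ∀ {n} {c : Cube n} {L} →
      FamilyIn c L → ∪-Closed L → ChainsBounded L (suc k) →
      ℕtoℚ (length L) ≤ interpolant ℓ p k (dim c)
    interpolated-bound k _ {c = c} {[]}     _ _ _ = ≤1⇒≤interpolant ℓ p k (dim c) ℕ.z≤n
    interpolated-bound k _ {c = c} {_ ∷ []} _ _ _ = ≤1⇒≤interpolant ℓ p k (dim c) (ℕ.s≤s ℕ.z≤n)
    interpolated-bound k k≤ℓ {c = c} {L@(_ ∷ _ ∷ _)} fam closed bounded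
      with separating-coordinate (members fam) (⋃-∈ closed (All.tabulate id)) ⊆⋃
             (here refl) (there (here refl)) (All.head (AllPairs.head (unique fam)))
    ... | i , free , Tᵢ , a , a∈L , aᵢ = split k k≤ℓ bounded
      where
      T∈L : ⋃ L ∈ L
      T∈L = ⋃-∈ closed (All.tabulate id)
      d  = dim (fix c i true)
      L₁ = slice i true L
      L₀ = slice i false L
      S  = ℕtoℚ (geomSum ℓ p)
      B  = bound2 d ℓ p

      split : ∀ j → j ℕ.≤ ℓ → ChainsBounded L (suc j) →
              ℕtoℚ (length L) ≤ interpolant ℓ p j (dim c)
      split zero _ chains with slice-outside-chainsBounded T∈L ⊆⋃ Tᵢ chains
                                 (a ∷ []) (singleton-chain (∈-slice⁺ a∈L aᵢ))
      ... | ()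
      split (suc j) j<ℓ chains = begin
        ℕtoℚ (length L)
          ≡⟨ cong ℕtoℚ (length-slices i L) ⟩
        ℕtoℚ (length L₁ ℕ.+ length L₀)
          ≡⟨ ℕtoℚ-+ (length L₁) (length L₀) ⟩
        ℕtoℚ (length L₁) + ℕtoℚ (length L₀)
          ≤⟨ +-mono-≤ bound₁ bound₀ ⟩
        (S + B) + (1ℚ + (ℕtoℚ j * S + B * (1ℚ - powℚ ½ j)))
          ≡⟨ interpolation-step S B (ℕtoℚ j) (powℚ ½ j) ⟩
        1ℚ + ((1ℚ + ℕtoℚ j) * S + (ℕtoℚ 2 * B) * (1ℚ - powℚ ½ (suc j)))
          ≡⟨ cong₂ (λ x y → 1ℚ + (x * S + y * (1ℚ - powℚ ½ (suc j)))) (sym (ℕtoℚ-+ 1 j)) (sym double) ⟩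
        interpolant ℓ p (suc j) (dim c) ∎
        where
        open ≤-Reasoning
        double : bound2 (dim c) ℓ p ≡ ℕtoℚ 2 * B
        double = trans (cong (λ e → bound2 e ℓ p) (dim-fix c true free)) (bound2-suc-dim d ℓ p)
        dim₀ : dim (fix c i false) ≡ d
        dim₀ = ℕₚ.suc-injective (trans (sym (dim-fix c false free)) (dim-fix c true free))
        bound₁ : ℕtoℚ (length L₁) ≤ S + B
        bound₁ = bound-p (slice-familyIn i true fam) (slice-∪-closed i true closed)
          (slice-chainsBounded i true λ C chain → ℕₚ.≤-trans (chains C chain) (ℕ.s≤s j<ℓ))
        bound₀ : ℕtoℚ (length L₀) ≤ interpolant ℓ p j d
        bound₀ = subst (λ e → ℕtoℚ (length L₀) ≤ interpolant ℓ p j e) dim₀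
          (interpolated-bound j (ℕₚ.<⇒≤ j<ℓ) (slice-familyIn i false fam)
             (slice-∪-closed i false closed) (slice-outside-chainsBounded T∈L ⊆⋃ Tᵢ chains))

  geometricBound-suc : ∀ {ℓ p} → GeometricBound ℓ p → GeometricBound ℓ (suc p)
  geometricBound-suc {ℓ} {p} bound-p {c = c} {L} fam closed chains = begin
    ℕtoℚ (length L)
      ≤⟨ interpolated-bound {ℓ} {p} bound-p ℓ ℕₚ.≤-refl fam closed chains ⟩
    1ℚ + (ℕtoℚ ℓ * S + bound2 (dim c) ℓ p * q)
      ≡⟨ sym (+-assoc 1ℚ (ℕtoℚ ℓ * S) _) ⟩
    (1ℚ + ℕtoℚ ℓ * S) + bound2 (dim c) ℓ p * q
      ≡⟨ cong₂ _+_ (sym (ℕtoℚ-geomSum-suc ℓ p)) (sym (bound2-suc-exp (dim c) ℓ p)) ⟩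
    ℕtoℚ (geomSum ℓ (suc p)) + bound2 (dim c) ℓ (suc p) ∎
    where
    open ≤-Reasoning
    S = ℕtoℚ (geomSum ℓ p)
    q = 1ℚ - powℚ ½ ℓ

  geometricBound : ∀ ℓ p → GeometricBound ℓ p
  geometricBound ℓ zero    = geometricBound-zero {ℓ}
  geometricBound ℓ (suc p) = geometricBound-suc {ℓ} {p} (geometricBound ℓ p)

mainTheorem3 : (n : ℕ) (F : Family n) → Universe F ≡ ⊤ → UnionClosed F →
    (ℓ : ℕ) → HasLength F ℓ → (p : ℕ) →
    ℕtoℚ ∣ F ∣F ℚ.≤ ℕtoℚ (geomSum ℓ p) ℚ.+ bound2 n ℓ p
mainTheorem3 n F _ closed ℓ (_ , chains) p =
  subst (λ d → ℕtoℚ ∣ F ∣F ℚ.≤ ℕtoℚ (geomSum ℓ p) ℚ.+ bound2 d ℓ p) (dim-full n)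
    (geometricBound ℓ p whole closed chains)
  where
  whole : FamilyIn (full n) (sets F)
  whole = record { unique = distinct F ; members = All.tabulate λ {X} _ → ∈ᶜ-full X }
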